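{- For any triangle-free outerplanar graph $G$, $\chi_{vi,1}(G)\leq \Delta(G)+3$.
   Context: All graphs are finite, simple and undirected. An incidence of $G$ is a pair $(v,e)$ with $v\in V(G)$, $e\in E(G)$, $v\in e$; $I(G)$ is the set of incidences. Let $G^{1/3}$ be obtained from $G$ by replacing each edge $e=\{u,v\}$ by the path $u,(u,e),(v,e),v$. A $vi$-simultaneous proper $k$-coloring of $G$ is a map $c:V(G)\cup I(G)\to\{1,\dots,k\}$ such that any two distinct elements at distance at most $3$ in $G^{1/3}$ receive distinct colors. For a vertex $v$, $I_2(v)=\{(u,\{u,v\}) : u\in N_G(v)\}$. Such a coloring is a $(k,s)$-coloring if for every vertex $v$ at most $s$ distinct colors appear on $I_2(v)$; $\chi_{vi,s}(G)$ is the least such $k$. A graph is triangle-free if it contains no cycle of length $3$. A graph is outerplanar if it has a planar drawing with all vertices on the outer face. -}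

module Defs where

open import Data.Nat using (ℕ; zero; suc; _+_; _≤_; _<_; _⊔_)
open import Data.Fin using (Fin; toℕ)
open import Data.Bool using (Bool; true; false; if_then_else_)
open import Data.List using (List; map; foldr; allFin; length)
open import Data.Nat.ListAction using (sum)
open import Data.List.Membership.Propositional using (_∈_)
open import Data.Product using (Σ; _×_; _,_; ∃; ∃-syntax)
open import Data.Sum using (_⊎_; inj₁; inj₂)
open import Data.Empty using (⊥)
open import Function.Bundles using (_↔_; Inverse)
open import Relation.Nullary using (¬_)
open import Relation.Binary.PropositionalEquality using (_≡_; _≢_)

record Graph (n : ℕ) : Set where
  field
    adj     : Fin n → Fin n → Bool
    symm    : ∀ u v → adj u v ≡ adj v u
    irrefl  : ∀ v → adj v v ≡ false

open Graph public

Adj : ∀ {n} → Graph n → Fin n → Fin n → Set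
Adj G u v = adj G u v ≡ true

degree : ∀ {n} → Graph n → Fin n → ℕ
degree {n} G v = sum (map (λ u → if adj G v u then 1 else 0) (allFin n))

Δ : ∀ {n} → Graph n → ℕ
Δ {n} G = foldr _⊔_ 0 (map (degree G) (allFin n))

-- triangle-free: no three pairwise adjacent vertices (distinctness follows from irreflexivity)
TriangleFree : ∀ {n} → Graph n → Set
TriangleFree G = ∀ a b c → Adj G a b → Adj G b c → Adj G a c → ⊥

-- Outerplanar: the vertices can be placed (bijectively) at positions 0..n-1 around a circle
-- such that no two edges, drawn as chords, cross (i.e. have interleaving endpoints).
Crossing : ℕ → ℕ → ℕ → ℕ → Set
Crossing a b c d = a < c × c < b × b < d

Outerplanar : ∀ {n} → Graph n → Set
Outerplanar {n} G = Σ (Fin n ↔ Fin n) λ σ →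
  ∀ a b c d → Adj G a b → Adj G c d →
    ¬ Crossing (toℕ (Inverse.to σ a)) (toℕ (Inverse.to σ b)) (toℕ (Inverse.to σ c)) (toℕ (Inverse.to σ d))

-- Incidences: (v , u , p) stands for the incidence (v , {v,u}).
Incidence : ∀ {n} → Graph n → Set
Incidence {n} G = Σ (Fin n) λ v → Σ (Fin n) λ u → Adj G v u

-- Vertices of G^{1/3}: vertices of G and incidences of G.
Node : ∀ {n} → Graph n → Set
Node {n} G = Fin n ⊎ Incidence G

-- Adjacency in G^{1/3}: edge {u,v} becomes the path u,(u,e),(v,e),v.
SubAdj : ∀ {n} (G : Graph n) → Node G → Node G → Set
SubAdj G (inj₁ v) (inj₁ w) = ⊥
SubAdj G (inj₁ v) (inj₂ (w , u , _)) = v ≡ w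
SubAdj G (inj₂ (w , u , _)) (inj₁ v) = v ≡ w
SubAdj G (inj₂ (a , b , _)) (inj₂ (c , d , _)) = (a ≡ d) × (b ≡ c)

WithinDist : ∀ {n} (G : Graph n) → ℕ → Node G → Node G → Set
WithinDist G zero x y = x ≡ y
WithinDist G (suc k) x y = WithinDist G k x y ⊎ (∃[ z ] (SubAdj G x z × WithinDist G k z y))

IsVIColoring : ∀ {n} (G : Graph n) (k : ℕ) → (Node G → Fin k) → Set
IsVIColoring G k c = ∀ x y → x ≢ y → WithinDist G 3 x y → c x ≢ c y

-- I₂(v) = {(u,{u,v}) : u ∈ N(v)}; at most s distinct colours on it.
AtMostColorsOnI₂ : ∀ {n} (G : Graph n) (k s : ℕ) → (Node G → Fin k) → Set
AtMostColorsOnI₂ {n} G k s c = ∀ (v : Fin n) → Σ (List (Fin k)) λ S → length S ≤ s ×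
  (∀ (u : Fin n) (p : Adj G u v) → c (inj₂ (u , v , p)) ∈ S)

HasVISColoring : ∀ {n} (G : Graph n) (k s : ℕ) → Set
HasVISColoring G k s = Σ (Node G → Fin k) λ c → IsVIColoring G k c × AtMostColorsOnI₂ G k s c

-- A (k,1)-colouring amounts to colouring 2n slots: each vertex v, and the class I₂(v), whose
-- incidences all get one colour; two slots must differ when they colour elements within
-- distance 3 in G^{1/3}. A triangle-free outerplanar graph with an edge contains a vertex of
-- degree 1, a 4-cycle a x y b with deg x = deg y = 2, or a path a x y z b with
-- deg x = deg y = deg z = 2: take a shortest chord of the drawing that passes over a
-- non-isolated vertex, and walk right from the first such vertex. Deleting the edges at
-- x, y (, z) lowers the degree sum, so the rest is (Δ+3)-coloured by induction and the slots
-- of x, y (, z) are coloured back one at a time, each avoiding at most Δ+2 colours. Where a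
-- slot would face Δ+3 colours, an earlier slot copies the colour of a slot it already
-- conflicts with; on the path a x y z b the choice depends on whether a already has the
-- colour of I₂(b), and b that of I₂(a).
module Submission where

open import Defs
open import Data.Nat using (ℕ; suc; _+_; _∸_; _≤_; _<_; _⊔_; z≤n; s≤s)

open import Axiom.UniquenessOfIdentityProofs using (module Decidable⇒UIP)
open import Data.Bool using (Bool; true; false; _∧_; not; if_then_else_)
open import Data.Bool.Properties using (∧-comm) renaming (_≟_ to _≟ᵇ_)
open import Data.Empty using (⊥; ⊥-elim)
open import Data.Fin using (Fin; toℕ; _↑ʳ_) renaming (zero to fzero; suc to fsuc)
open import Data.Fin.Properties using (any?; ¬∀⟶∃¬; <⇒notInjective; toℕ-injective; ↑ʳ-injective) renaming (_≟_ to _≟ᶠ_)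
open import Data.List using (List; []; _∷_; map; length; filter; allFin; foldr; lookup; cartesianProduct)
open import Data.List.Properties using (length-map)
open import Data.List.Extrema.Nat using (argmin; f[argmin]≤f[xs]; argmin-all)
open import Data.List.Membership.Propositional using (_∈_; _∉_)
open import Data.List.Membership.Propositional.Properties
  using (∈-allFin; ∈-map⁺; ∈-map⁻; ∈-filter⁺; ∈-length; ∈-cartesianProduct⁺)
open import Data.List.Relation.Unary.All as All using (All; []; _∷_)
open import Data.List.Relation.Unary.All.Properties using (all-filter; All¬⇒¬Any)
open import Data.List.Relation.Unary.Any as Any using (here; there)
open import Data.List.Relation.Unary.Any.Properties using (lookup-index)
open import Data.Nat.Induction using (<-wellFounded)
open import Data.Nat.ListAction using (sum)
open import Data.Nat.Properties
  using (≤-refl; ≤-trans; ≤-reflexive; +-comm; <-trans; <-irrefl; <-cmp; <⇒≤; <⇒≱; ≮⇒≥; ≤∧≢⇒<; _<?_;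
         <-≤-trans; ≤-<-trans; ∸-monoˡ-≤; ∸-monoʳ-≤; ∸-monoˡ-<; ∸-monoʳ-<; m≤m⊔n; m≤n⊔m; m≤n⇒m≤1+n; +-mono-≤; +-mono-<-≤; +-mono-≤-<)
open import Data.Product using (Σ; ∃; ∃-syntax; _×_; _,_; proj₁; proj₂; uncurry)
open import Data.Sum using (_⊎_; inj₁; inj₂; [_,_]; map₂; swap)
open import Function using (id; _∘_; _∘₂_)
open import Function.Bundles using (Inverse; Injection)
open import Function.Definitions using (Injective)
open import Function.Properties.Inverse using (↔⇒↣)
import Induction.WellFounded as WF
open import Relation.Binary.Definitions using (DecidableEquality; tri<; tri≈; tri>)
import Relation.Binary.Construct.On as On
open import Relation.Binary.PropositionalEquality
  using (_≡_; _≢_; refl; sym; trans; cong; subst)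
open import Relation.Nullary using (¬_; Dec; yes; no; does)
open import Relation.Nullary.Decidable as Dec using (dec-true; dec-false; _×-dec_)
open import Relation.Unary using (Decidable)

length<⇒∃∉ : ∀ {k} (xs : List (Fin k)) → length xs < k → ∃ λ i → i ∉ xs
length<⇒∃∉ {k} xs len = ¬∀⟶∃¬ k (_∈ xs) (λ i → Any.any? (i ≟ᶠ_) xs) not-all
  where
    not-all : ¬ (∀ i → i ∈ xs)
    not-all all = <⇒notInjective len index-injective
      where
        index-injective : Injective _≡_ _≡_ (λ i → Any.index (all i))
        index-injective {i} {j} e =
          trans (lookup-index (all i)) (trans (cong (lookup xs) e) (sym (lookup-index (all j))))

module _ {A : Set} (measure : A → ℕ) {P : A → Set} (P? : Decidable P)
         (xs : List A) (complete : ∀ x → x ∈ xs) where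

  minimal-witness : ∀ {x₀} → P x₀ → Σ A λ x → P x × (∀ y → P y → measure x ≤ measure y)
  minimal-witness {x₀} px₀ =
    argmin measure x₀ ys , argmin-all measure px₀ (all-filter P? xs) ,
    λ y py → All.lookup (f[argmin]≤f[xs] x₀ ys) (∈-filter⁺ P? (complete y) py)
    where ys = filter P? xs

module _ {A : Set} {f g : A → ℕ} (f≤g : ∀ x → f x ≤ g x) where

  sum-map-mono-≤ : ∀ xs → sum (map f xs) ≤ sum (map g xs)
  sum-map-mono-≤ [] = z≤n
  sum-map-mono-≤ (x ∷ xs) = +-mono-≤ (f≤g x) (sum-map-mono-≤ xs)

  sum-map-mono-< : ∀ {x xs} → x ∈ xs → f x < g x → sum (map f xs) < sum (map g xs)
  sum-map-mono-< {xs = _ ∷ xs} (here refl) fx<gx = +-mono-<-≤ fx<gx (sum-map-mono-≤ xs)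
  sum-map-mono-< {xs = y ∷ _} (there x∈) fx<gx = +-mono-≤-< (f≤g y) (sum-map-mono-< x∈ fx<gx)

∈-distinct⇒2≤length : ∀ {A : Set} {x y : A} {xs} → x ∈ xs → y ∈ xs → x ≢ y → 2 ≤ length xs
∈-distinct⇒2≤length (here refl) (here refl) x≢y = ⊥-elim (x≢y refl)
∈-distinct⇒2≤length (here refl) (there y∈) _ = s≤s (∈-length y∈)
∈-distinct⇒2≤length (there x∈) (here refl) _ = s≤s (∈-length x∈)
∈-distinct⇒2≤length (there x∈) (there y∈) x≢y = m≤n⇒m≤1+n (∈-distinct⇒2≤length x∈ y∈ x≢y)

indicator-∧-≤ : ∀ b c → (if b ∧ c then 1 else 0) ≤ (if b then 1 else 0)
indicator-∧-≤ false _ = z≤n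
indicator-∧-≤ true false = z≤n
indicator-∧-≤ true true = ≤-refl

module _ {n : ℕ} (G : Graph n) where

  Adj-sym : ∀ {u v} → Adj G u v → Adj G v u
  Adj-sym {u} {v} a = trans (symm G v u) a

  Adj-irrefl : ∀ {u} → ¬ Adj G u u
  Adj-irrefl {u} a with () ← trans (sym a) (irrefl G u)

  Adj⇒≢ : ∀ {u v} → Adj G u v → u ≢ v
  Adj⇒≢ a refl = Adj-irrefl a

  Adj-irrelevant : ∀ {u v} (a b : Adj G u v) → a ≡ b
  Adj-irrelevant = Decidable⇒UIP.≡-irrelevant _≟ᵇ_

  Adj? : ∀ u v → Dec (Adj G u v)
  Adj? u v = adj G u v ≟ᵇ true

  neighbours : Fin n → List (Fin n)
  neighbours v = filter (Adj? v) (allFin n)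

  ∈-neighbours⁺ : ∀ {v w} → Adj G v w → w ∈ neighbours v
  ∈-neighbours⁺ {v} {w} a = ∈-filter⁺ (Adj? v) (∈-allFin w) a

  length-neighbours : ∀ v → length (neighbours v) ≡ degree G v
  length-neighbours v = count (allFin n)
    where
      count : ∀ us → length (filter (Adj? v) us) ≡ sum (map (λ u → if adj G v u then 1 else 0) us)
      count [] = refl
      count (u ∷ us) with adj G v u
      ... | true = cong suc (count us)
      ... | false = count us

  degree≤Δ : ∀ v → degree G v ≤ Δ G
  degree≤Δ v = ≤-foldr-⊔ (∈-map⁺ (degree G) (∈-allFin v))
    where
      ≤-foldr-⊔ : ∀ {m ms} → m ∈ ms → m ≤ foldr _⊔_ 0 ms
      ≤-foldr-⊔ {ms = m ∷ _} (here refl) = m≤m⊔n m _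
      ≤-foldr-⊔ {ms = m ∷ _} (there m∈) = ≤-trans (≤-foldr-⊔ m∈) (m≤n⊔m m _)

  1≤degree : ∀ {u v} → Adj G u v → 1 ≤ degree G u
  1≤degree {u} a = subst (1 ≤_) (length-neighbours u) (∈-length (∈-neighbours⁺ a))

  2≤degree : ∀ {u v w} → Adj G u v → Adj G u w → v ≢ w → 2 ≤ degree G u
  2≤degree {u} a b v≢w =
    subst (2 ≤_) (length-neighbours u) (∈-distinct⇒2≤length (∈-neighbours⁺ a) (∈-neighbours⁺ b) v≢w)

  degree-sum : ℕ
  degree-sum = sum (map (degree G) (allFin n))

_∈ᵇ_ : ∀ {n} → Fin n → List (Fin n) → Bool
u ∈ᵇ S = does (Any.any? (u ≟ᶠ_) S)

_∖_ : ∀ {n} → Graph n → List (Fin n) → Graph n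
adj (G ∖ S) u v = adj G u v ∧ not (u ∈ᵇ S) ∧ not (v ∈ᵇ S)
symm (G ∖ S) u v rewrite symm G u v = cong (adj G v u ∧_) (∧-comm (not (u ∈ᵇ S)) (not (v ∈ᵇ S)))
irrefl (G ∖ S) v rewrite irrefl G v = refl

module _ {n : ℕ} (G : Graph n) (S : List (Fin n)) where

  ∖-Adj⁻ : ∀ {u v} → Adj (G ∖ S) u v → Adj G u v
  ∖-Adj⁻ {u} {v} a with adj G u v
  ... | true = refl
  ... | false = a

  ∖-Adj⁺ : ∀ {u v} → Adj G u v → u ∉ S → v ∉ S → Adj (G ∖ S) u v
  ∖-Adj⁺ {u} {v} a u∉ v∉
    rewrite a | dec-false (Any.any? (u ≟ᶠ_) S) u∉ | dec-false (Any.any? (v ≟ᶠ_) S) v∉ = refl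

  degree-∖-≤ : ∀ v → degree (G ∖ S) v ≤ degree G v
  degree-∖-≤ v = sum-map-mono-≤ (λ u → indicator-∧-≤ (adj G v u) _) (allFin n)

  degree-∖-< : ∀ {s w} → s ∈ S → Adj G s w → degree (G ∖ S) s < degree G s
  degree-∖-< {s} {w} s∈ a = sum-map-mono-< (λ u → indicator-∧-≤ (adj G s u) _) (∈-allFin w) removed
    where
      removed : (if adj (G ∖ S) s w then 1 else 0) < (if adj G s w then 1 else 0)
      removed rewrite a | dec-true (Any.any? (s ≟ᶠ_) S) s∈ = s≤s z≤n

  degree-sum-∖-< : ∀ {s w} → s ∈ S → Adj G s w → degree-sum (G ∖ S) < degree-sum G
  degree-sum-∖-< {s} s∈ a = sum-map-mono-< degree-∖-≤ (∈-allFin s) (degree-∖-< s∈ a)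

-- Slots and conflicts

-- In a (k,1)-colouring all incidences of I₂(v) share one colour; the slot inc v carries it.
data Slot (n : ℕ) : Set where
  vtx inc : Fin n → Slot n

module _ {n : ℕ} where

  vtx-≢ : ∀ {u v : Fin n} → u ≢ v → vtx u ≢ vtx v
  vtx-≢ u≢v refl = u≢v refl

  inc-≢ : ∀ {u v : Fin n} → u ≢ v → inc u ≢ inc v
  inc-≢ u≢v refl = u≢v refl

  vtx-injective : ∀ {u v : Fin n} → vtx u ≡ vtx v → u ≡ v
  vtx-injective refl = refl

  inc-injective : ∀ {u v : Fin n} → inc u ≡ inc v → u ≡ v
  inc-injective refl = refl

  _≟ˢ_ : DecidableEquality (Slot n)
  vtx u ≟ˢ vtx v = Dec.map′ (cong vtx) vtx-injective (u ≟ᶠ v)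
  inc u ≟ˢ inc v = Dec.map′ (cong inc) inc-injective (u ≟ᶠ v)
  vtx _ ≟ˢ inc _ = no λ ()
  inc _ ≟ˢ vtx _ = no λ ()

  inc∉map-vtx : ∀ {v : Fin n} vs → inc v ∉ map vtx vs
  inc∉map-vtx (_ ∷ _) (here ())
  inc∉map-vtx (_ ∷ vs) (there v∈) = inc∉map-vtx vs v∈

  vtx∉ : ∀ {v : Fin n} {vs} → v ∉ vs → vtx v ∉ map vtx vs
  vtx∉ v∉ v∈ with ∈-map⁻ vtx v∈
  ... | _ , w∈ , refl = v∉ w∈

module _ {n : ℕ} (G : Graph n) where

  -- Slots colouring elements that can lie within distance 3 of each other in G^{1/3}.
  Conflict : Slot n → Slot n → Set
  Conflict (vtx u) (vtx v) = Adj G u v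
  Conflict (vtx u) (inc v) = u ≡ v ⊎ Adj G u v
  Conflict (inc u) (vtx v) = u ≡ v ⊎ Adj G u v
  Conflict (inc u) (inc v) = Adj G u v ⊎ ∃[ w ] (Adj G w u × Adj G w v × u ≢ v)

  Conflict-sym : ∀ p q → Conflict p q → Conflict q p
  Conflict-sym (vtx u) (vtx v) a = Adj-sym G a
  Conflict-sym (vtx u) (inc v) (inj₁ e) = inj₁ (sym e)
  Conflict-sym (vtx u) (inc v) (inj₂ a) = inj₂ (Adj-sym G a)
  Conflict-sym (inc u) (vtx v) (inj₁ e) = inj₁ (sym e)
  Conflict-sym (inc u) (vtx v) (inj₂ a) = inj₂ (Adj-sym G a)
  Conflict-sym (inc u) (inc v) (inj₁ a) = inj₁ (Adj-sym G a)
  Conflict-sym (inc u) (inc v) (inj₂ (w , a , b , u≢v)) = inj₂ (w , b , a , λ e → u≢v (sym e))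

  Conflict-irrefl : ∀ p → ¬ Conflict p p
  Conflict-irrefl (vtx u) a = Adj-irrefl G a
  Conflict-irrefl (inc u) (inj₁ a) = Adj-irrefl G a
  Conflict-irrefl (inc u) (inj₂ (_ , _ , _ , u≢u)) = u≢u refl

  -- The incidence (u , v , _) stands for (u , {u,v}), which lies in I₂(v).
  slot : Node G → Slot n
  slot (inj₁ v) = vtx v
  slot (inj₂ (_ , v , _)) = inc v

  private
    incidence-≡ : ∀ {u v} (a b : Adj G u v) → _≡_ {A = Node G} (inj₂ (u , v , a)) (inj₂ (u , v , b))
    incidence-≡ a b = cong (λ c → inj₂ (_ , _ , c)) (Adj-irrelevant G a b)

  1-step⇒Conflict : ∀ x y → SubAdj G x y → Conflict (slot x) (slot y)
  1-step⇒Conflict (inj₁ v) (inj₂ (.v , u , a)) refl = inj₂ a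
  1-step⇒Conflict (inj₂ (u , v , a)) (inj₁ .u) refl = inj₂ (Adj-sym G a)
  1-step⇒Conflict (inj₂ (u , v , a)) (inj₂ (.v , .u , _)) (refl , refl) = inj₁ (Adj-sym G a)

  2-step⇒Conflict : ∀ x z y → SubAdj G x z → SubAdj G z y → x ≢ y → Conflict (slot x) (slot y)
  2-step⇒Conflict (inj₁ v) (inj₂ (.v , u , a)) (inj₁ .v) refl refl x≢y = ⊥-elim (x≢y refl)
  2-step⇒Conflict (inj₁ v) (inj₂ (.v , u , a)) (inj₂ (.u , .v , _)) refl (refl , refl) _ = inj₁ refl
  2-step⇒Conflict (inj₂ (u , v , a)) (inj₁ .u) (inj₂ (.u , w , b)) refl refl x≢y with v ≟ᶠ w
  ... | yes refl = ⊥-elim (x≢y (incidence-≡ a b))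
  ... | no v≢w = inj₂ (u , a , b , v≢w)
  2-step⇒Conflict (inj₂ (u , v , a)) (inj₂ (.v , .u , _)) (inj₁ .v) (refl , refl) refl _ = inj₁ refl
  2-step⇒Conflict (inj₂ (u , v , a)) (inj₂ (.v , .u , _)) (inj₂ (.u , .v , c)) (refl , refl) (refl , refl) x≢y =
    ⊥-elim (x≢y (incidence-≡ a c))

  3-step⇒Conflict : ∀ x z w y → SubAdj G x z → SubAdj G z w → SubAdj G w y → Conflict (slot x) (slot y)
  3-step⇒Conflict (inj₁ v) (inj₂ (.v , _ , _)) (inj₁ .v) (inj₂ (.v , _ , b)) refl refl refl = inj₂ b
  3-step⇒Conflict (inj₁ v) (inj₂ (.v , _ , a)) (inj₂ _) (inj₁ _) refl (refl , refl) refl = a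
  3-step⇒Conflict (inj₁ v) (inj₂ (.v , _ , a)) (inj₂ _) (inj₂ _) refl (refl , refl) (refl , refl) = inj₂ a
  3-step⇒Conflict (inj₂ (_ , _ , a)) (inj₁ _) (inj₂ _) (inj₁ _) refl refl refl = inj₂ (Adj-sym G a)
  3-step⇒Conflict (inj₂ (_ , _ , a)) (inj₁ _) (inj₂ _) (inj₂ _) refl refl (refl , refl) = inj₁ (Adj-sym G a)
  3-step⇒Conflict (inj₂ _) (inj₂ _) (inj₁ _) (inj₂ (_ , _ , c)) (refl , refl) refl refl = inj₁ c
  3-step⇒Conflict (inj₂ (_ , _ , a)) (inj₂ _) (inj₂ _) (inj₁ _) (refl , refl) (refl , refl) refl = inj₂ (Adj-sym G a)
  3-step⇒Conflict (inj₂ (_ , _ , a)) (inj₂ _) (inj₂ _) (inj₂ _) (refl , refl) (refl , refl) (refl , refl) = inj₁ (Adj-sym G a)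

  within3⇒Conflict : ∀ x y → x ≢ y → WithinDist G 3 x y → Conflict (slot x) (slot y)
  within3⇒Conflict x y x≢y (inj₁ (inj₁ (inj₁ refl))) = ⊥-elim (x≢y refl)
  within3⇒Conflict x y _ (inj₁ (inj₁ (inj₂ (z , a , refl)))) = 1-step⇒Conflict x y a
  within3⇒Conflict x y _ (inj₁ (inj₂ (z , a , inj₁ refl))) = 1-step⇒Conflict x y a
  within3⇒Conflict x y x≢y (inj₁ (inj₂ (z , a , inj₂ (w , b , refl)))) = 2-step⇒Conflict x z y a b x≢y
  within3⇒Conflict x y _ (inj₂ (z , a , inj₁ (inj₁ refl))) = 1-step⇒Conflict x y a
  within3⇒Conflict x y x≢y (inj₂ (z , a , inj₁ (inj₂ (w , b , refl)))) = 2-step⇒Conflict x z y a b x≢y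
  within3⇒Conflict x y x≢y (inj₂ (z , a , inj₂ (w , b , inj₁ refl))) = 2-step⇒Conflict x z y a b x≢y
  within3⇒Conflict x y _ (inj₂ (z , a , inj₂ (w , b , inj₂ (t , c , refl)))) = 3-step⇒Conflict x z w y a b c

Colouring : ℕ → ℕ → Set
Colouring n k = Slot n → Fin k

ConflictFree : ∀ {n k} → Graph n → Colouring n k → Set
ConflictFree G col = ∀ p q → Conflict G p q → col p ≢ col q

ConflictFree⇒HasVISColoring : ∀ {n k} (G : Graph n) (col : Colouring n k) →
                              ConflictFree G col → HasVISColoring G k 1
ConflictFree⇒HasVISColoring G col proper =
  col ∘ slot G ,
  (λ x y x≢y d → proper (slot G x) (slot G y) (within3⇒Conflict G x y x≢y d)) ,
  λ v → col (inc v) ∷ [] , s≤s z≤n , λ _ _ → here refl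

Colourable : ∀ {n} → Graph n → ℕ → Set
Colourable {n} G k = Σ (Colouring n k) (ConflictFree G)

OnlyNeighbours : ∀ {n} → Graph n → Fin n → Fin n → Fin n → Set
OnlyNeighbours G s l r = ∀ w → Adj G s w → w ≡ l ⊎ w ≡ r

OnlyNeighbour : ∀ {n} → Graph n → Fin n → Fin n → Set
OnlyNeighbour G s t = ∀ w → Adj G s w → w ≡ t

-- Extending partial colourings

module PartialColouring {n : ℕ} (G : Graph n) (k : ℕ) where

  ConflictFreeOutside : Colouring n k → List (Slot n) → Set
  ConflictFreeOutside col rem = ∀ p q → Conflict G p q → p ∉ rem → q ∉ rem → col p ≢ col q

  ConflictFreeOutside-[] : ∀ {col} → ConflictFreeOutside col [] → ConflictFree G col
  ConflictFreeOutside-[] free p q c = free p q c (λ ()) (λ ())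

  Available : Colouring n k → List (Slot n) → Slot n → Fin k → Set
  Available col rem p χ = ∀ q → Conflict G p q → q ∈ rem ⊎ χ ≢ col q

  opaque
    _[_↦_] : Colouring n k → Slot n → Fin k → Colouring n k
    (col [ p ↦ χ ]) q with q ≟ˢ p
    ... | yes _ = χ
    ... | no _ = col q

    ↦-same : ∀ col p χ → (col [ p ↦ χ ]) p ≡ χ
    ↦-same col p χ with p ≟ˢ p
    ... | yes _ = refl
    ... | no p≢p = ⊥-elim (p≢p refl)

    ↦-other : ∀ col p χ {q} → q ≢ p → (col [ p ↦ χ ]) q ≡ col q
    ↦-other col p χ {q} q≢p with q ≟ˢ p
    ... | yes q≡p = ⊥-elim (q≢p q≡p)
    ... | no _ = refl

    extend : ∀ {col p rem χ} → ConflictFreeOutside col (p ∷ rem) → Available col rem p χ →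
             ConflictFreeOutside (col [ p ↦ χ ]) rem
    extend {col} {p} {rem} {χ} free avail q r c q∉ r∉ with q ≟ˢ p | r ≟ˢ p
    ... | yes refl | yes refl = ⊥-elim (Conflict-irrefl G q c)
    ... | yes refl | no _ = [ (λ r∈ → ⊥-elim (r∉ r∈)) , (λ χ≢ → χ≢) ] (avail r c)
    ... | no _ | yes refl = [ (λ q∈ → ⊥-elim (q∉ q∈)) , (λ χ≢ → χ≢ ∘ sym) ] (avail q (Conflict-sym G q r c))
    ... | no q≢p | no r≢p = free q r c (λ { (here e) → q≢p e ; (there q∈) → q∉ q∈ })
                                       (λ { (here e) → r≢p e ; (there r∈) → r∉ r∈ })

  ↦-preserves-≡ : ∀ col p χ {q r} → q ≢ p → r ≢ p → col q ≡ col r → (col [ p ↦ χ ]) q ≡ (col [ p ↦ χ ]) r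
  ↦-preserves-≡ col p χ q≢p r≢p e = trans (↦-other col p χ q≢p) (trans e (sym (↦-other col p χ r≢p)))

  colour-≢ : ∀ {col rem p q r} → ConflictFreeOutside col rem → Conflict G p r → p ∉ rem → r ∉ rem →
             col q ≡ col r → col p ≢ col q
  colour-≢ free c p∉ r∉ q≡r p≡q = free _ _ c p∉ r∉ (trans p≡q q≡r)

  Covered : Colouring n k → List (Slot n) → List (Slot n) → Slot n → Set
  Covered col rem L q = q ∈ rem ⊎ ∃[ r ] (r ∈ L × col q ≡ col r)

  available-colour : ∀ {col rem p} L → length L < k → (∀ q → Conflict G p q → Covered col rem L q) →
                     ∃ (Available col rem p)
  available-colour {col} L short covered with length<⇒∃∉ (map col L) (subst (_< k) (sym (length-map col L)) short)
  ... | χ , χ∉ = χ , λ q c → map₂ (differs q) (covered q c)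
    where
      differs : ∀ q → ∃[ r ] (r ∈ L × col q ≡ col r) → χ ≢ col q
      differs q (r , r∈ , e) χ≡ = χ∉ (subst (_∈ map col L) (sym (trans χ≡ e)) (∈-map⁺ col r∈))

module ConflictCases {n : ℕ} (G : Graph n) {Q : Slot n → Set} where

  -- Q holds on the conflicts of inc s that arise through the neighbour t of s.
  record Through (s t : Fin n) : Set where
    constructor through
    field
      at-vtx : Q (vtx t)
      at-inc : Q (inc t)
      beyond : ∀ w → Adj G t w → w ≢ s → Q (inc w)

  through₂ : ∀ {s t r} → OnlyNeighbours G t s r → Q (vtx t) → Q (inc t) → Q (inc r) → Through s t
  through₂ N Qt Qt′ Qr = through Qt Qt′ beyond
    where
      beyond : ∀ w → Adj G _ w → w ≢ _ → Q (inc w)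
      beyond w tw w≢s with N w tw
      ... | inj₁ refl = ⊥-elim (w≢s refl)
      ... | inj₂ refl = Qr

  inc-conflicts : ∀ {s} → Q (vtx s) → (∀ t → Adj G s t → Through s t) → ∀ q → Conflict G (inc s) q → Q q
  inc-conflicts Qs Qt (vtx v) (inj₁ refl) = Qs
  inc-conflicts Qs Qt (vtx v) (inj₂ a) = Through.at-vtx (Qt v a)
  inc-conflicts Qs Qt (inc v) (inj₁ a) = Through.at-inc (Qt v a)
  inc-conflicts Qs Qt (inc v) (inj₂ (t , ts , tv , s≢v)) = Through.beyond (Qt t (Adj-sym G ts)) v tv (s≢v ∘ sym)

  inc-conflicts₂ : ∀ {s l r} → OnlyNeighbours G s l r → Q (vtx s) → Through s l → Through s r →
                   ∀ q → Conflict G (inc s) q → Q q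
  inc-conflicts₂ N Qs Ql Qr = inc-conflicts Qs via
    where
      via : ∀ t → Adj G _ t → Through _ t
      via t st with N t st
      ... | inj₁ refl = Ql
      ... | inj₂ refl = Qr

  vtx-conflicts₂ : ∀ {s l r} → OnlyNeighbours G s l r → Q (inc s) → Q (vtx l) × Q (inc l) → Q (vtx r) × Q (inc r) →
                   ∀ q → Conflict G (vtx s) q → Q q
  vtx-conflicts₂ N Qs Ql Qr (vtx v) a with N v a
  ... | inj₁ refl = proj₁ Ql
  ... | inj₂ refl = proj₁ Qr
  vtx-conflicts₂ N Qs Ql Qr (inc v) (inj₁ refl) = Qs
  vtx-conflicts₂ N Qs Ql Qr (inc v) (inj₂ a) with N v a
  ... | inj₁ refl = proj₂ Ql
  ... | inj₂ refl = proj₂ Qr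

  inc-conflicts₁ : ∀ {s t} → OnlyNeighbour G s t → Q (vtx s) → Through s t → ∀ q → Conflict G (inc s) q → Q q
  inc-conflicts₁ N Qs Qt = inc-conflicts₂ (λ w a → inj₁ (N w a)) Qs Qt Qt

  vtx-conflicts₁ : ∀ {s t} → OnlyNeighbour G s t → Q (inc s) → Q (vtx t) × Q (inc t) → ∀ q → Conflict G (vtx s) q → Q q
  vtx-conflicts₁ N Qs Qt = vtx-conflicts₂ (λ w a → inj₁ (N w a)) Qs Qt Qt

slot-vertex : ∀ {n} → Slot n → Fin n
slot-vertex (vtx v) = v
slot-vertex (inc v) = v

AllSlotsIn : ∀ {n} → List (Fin n) → List (Slot n) → Set
AllSlotsIn S rem = ∀ {v} → v ∈ S → vtx v ∈ rem × inc v ∈ rem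

AtMostOneNeighbourOutside : ∀ {n} → Graph n → List (Fin n) → Set
AtMostOneNeighbourOutside G S = ∀ {s u w} → s ∈ S → Adj G s u → Adj G s w → u ∉ S → w ∉ S → u ≡ w

neighbours-outside-agree : ∀ {n} (G : Graph n) {S : List (Fin n)} {s l r} → OnlyNeighbours G s l r → r ∈ S →
                           ∀ {u w} → Adj G s u → Adj G s w → u ∉ S → w ∉ S → u ≡ w
neighbours-outside-agree G {S} {s} {l} {r} N r∈ su sw u∉ w∉ = trans (towards-l su u∉) (sym (towards-l sw w∉))
  where
    towards-l : ∀ {u} → Adj G s u → u ∉ S → u ≡ l
    towards-l {u} su u∉ = [ id , (λ { refl → ⊥-elim (u∉ r∈) }) ] (N u su)

-- Two slots outside S conflict in G ∖ S unless their conflict runs through a common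
-- neighbour in S, and such a neighbour has at most one neighbour outside S.
ConflictFree-∖⇒ConflictFreeOutside : ∀ {n k} (G : Graph n) (S : List (Fin n)) {col : Colouring n k} {rem} →
                                     AtMostOneNeighbourOutside G S → AllSlotsIn S rem →
                                     ConflictFree (G ∖ S) col → PartialColouring.ConflictFreeOutside G k col rem
ConflictFree-∖⇒ConflictFreeOutside G S {rem = rem} one slots proper p q c p∉ q∉ =
  proper p q (lift p q c (outside p p∉) (outside q q∉))
  where
    outside : ∀ p → p ∉ rem → slot-vertex p ∉ S
    outside (vtx v) p∉ v∈ = p∉ (proj₁ (slots v∈))
    outside (inc v) p∉ v∈ = p∉ (proj₂ (slots v∈))

    keep : ∀ {u v} → Adj G u v → u ∉ S → v ∉ S → Adj (G ∖ S) u v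
    keep = ∖-Adj⁺ G S

    lift : ∀ p q → Conflict G p q → slot-vertex p ∉ S → slot-vertex q ∉ S → Conflict (G ∖ S) p q
    lift (vtx u) (vtx v) a u∉ v∉ = keep a u∉ v∉
    lift (vtx u) (inc v) (inj₁ e) _ _ = inj₁ e
    lift (vtx u) (inc v) (inj₂ a) u∉ v∉ = inj₂ (keep a u∉ v∉)
    lift (inc u) (vtx v) (inj₁ e) _ _ = inj₁ e
    lift (inc u) (vtx v) (inj₂ a) u∉ v∉ = inj₂ (keep a u∉ v∉)
    lift (inc u) (inc v) (inj₁ a) u∉ v∉ = inj₁ (keep a u∉ v∉)
    lift (inc u) (inc v) (inj₂ (w , wu , wv , u≢v)) u∉ v∉ with Any.any? (w ≟ᶠ_) S
    ... | yes w∈ = ⊥-elim (u≢v (one w∈ wu wv u∉ v∉))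
    ... | no w∉ = inj₂ (w , keep wu w∉ u∉ , keep wv w∉ v∉ , u≢v)

-- Reducible configurations

module _ {n : ℕ} (G : Graph n) where

  record Square : Set where
    field
      a x y b : Fin n
      ax : Adj G a x
      xy : Adj G x y
      yb : Adj G y b
      ab : Adj G a b
      x-nbrs : OnlyNeighbours G x a y
      y-nbrs : OnlyNeighbours G y x b
      a≢y : a ≢ y
      b≢x : b ≢ x

  record Chain : Set where
    field
      a x y z b : Fin n
      ax : Adj G a x
      xy : Adj G x y
      yz : Adj G y z
      zb : Adj G z b
      x-nbrs : OnlyNeighbours G x a y
      y-nbrs : OnlyNeighbours G y x z
      z-nbrs : OnlyNeighbours G z y b
      a≢y : a ≢ y
      a≢z : a ≢ z
      a≢b : a ≢ b
      b≢x : b ≢ x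
      b≢y : b ≢ y
      x≢z : x ≢ z

  reverse : Chain → Chain
  reverse c = record
    { a = b ; x = z ; y = y ; z = x ; b = a
    ; ax = Adj-sym G zb ; xy = Adj-sym G yz ; yz = Adj-sym G xy ; zb = Adj-sym G ax
    ; x-nbrs = swap ∘₂ z-nbrs ; y-nbrs = swap ∘₂ y-nbrs ; z-nbrs = swap ∘₂ x-nbrs
    ; a≢y = b≢y ; a≢z = b≢x ; a≢b = a≢b ∘ sym ; b≢x = a≢z ; b≢y = a≢y ; x≢z = x≢z ∘ sym }
    where open Chain c

  data Reducible : Set where
    leaf : ∀ {v u} → Adj G v u → OnlyNeighbour G v u → Reducible
    square : Square → Reducible
    chain : (c : Chain) → ∀ {w} → Adj G (Chain.a c) w → w ≢ Chain.x c → Reducible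

pattern #0 = here refl
pattern #1 = there #0
pattern #2 = there #1
pattern #3 = there #2
pattern #4 = there #3
pattern #5 = there #4

module Extension {n : ℕ} (G : Graph n) (D : ℕ) (degree≤D : ∀ v → degree G v ≤ D) where
  open PartialColouring G (D + 3)
  open ConflictCases G

  m≤D⇒2+m<D+3 : ∀ {m} → m ≤ D → 2 + m < D + 3
  m≤D⇒2+m<D+3 m≤D = ≤-trans (s≤s (s≤s (s≤s m≤D))) (≤-reflexive (+-comm 3 D))

  slots-around : Fin n → (Fin n → Slot n) → List (Slot n)
  slots-around a f = vtx a ∷ inc a ∷ map f (neighbours G a)

  length-slots-around< : ∀ a f → length (slots-around a f) < D + 3
  length-slots-around< a f =
    m≤D⇒2+m<D+3 (subst (_≤ D) (sym (trans (length-map f (neighbours G a)) (length-neighbours G a))) (degree≤D a))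

  ∈-around : ∀ {a w} f → Adj G a w → f w ∈ slots-around a f
  ∈-around f aw = there (there (∈-map⁺ f (∈-neighbours⁺ G aw)))

  redirect : Fin n → Slot n → Fin n → Slot n
  redirect x t w with w ≟ᶠ x
  ... | yes _ = t
  ... | no _ = inc w

  ∈-around-redirected : ∀ {a x t} → Adj G a x → t ∈ slots-around a (redirect x t)
  ∈-around-redirected {a} {x} {t} ax = subst (_∈ slots-around a (redirect x t)) hit (∈-around (redirect x t) ax)
    where
      hit : redirect x t x ≡ t
      hit with x ≟ᶠ x
      ... | yes _ = refl
      ... | no x≢x = ⊥-elim (x≢x refl)

  ∈-around-kept : ∀ {a x t w} → Adj G a w → w ≢ x → inc w ∈ slots-around a (redirect x t)
  ∈-around-kept {a} {x} {t} {w} aw w≢x = subst (_∈ slots-around a (redirect x t)) miss (∈-around (redirect x t) aw)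
    where
      miss : redirect x t w ≡ inc w
      miss with w ≟ᶠ x
      ... | yes w≡x = ⊥-elim (w≢x w≡x)
      ... | no _ = refl

  uncoloured : ∀ {A : Set} {q : Slot n} {rem} → q ∈ rem → q ∈ rem ⊎ A
  uncoloured = inj₁

  listed : ∀ {col rem L q} → q ∈ L → Covered col rem L q
  listed q∈ = inj₂ (_ , q∈ , refl)

  coloured-as : ∀ {col rem L q r} → r ∈ L → col q ≡ col r → Covered col rem L q
  coloured-as r∈ q≡r = inj₂ (_ , r∈ , q≡r)

  ↦-copied : ∀ col p r → r ≢ p → (col [ p ↦ col r ]) p ≡ (col [ p ↦ col r ]) r
  ↦-copied col p r r≢p = trans (↦-same col p (col r)) (sym (↦-other col p (col r) r≢p))

  leaf-extends : ∀ {v u col₀} → Adj G v u → OnlyNeighbour G v u →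
                 ConflictFreeOutside col₀ (inc v ∷ vtx v ∷ []) → Colourable G (D + 3)
  leaf-extends {v} {u} {col₀} vu N free₀ =
    col₁ [ vtx v ↦ proj₁ step₂ ] , ConflictFreeOutside-[] (extend (extend free₀ (proj₂ step₁)) (proj₂ step₂))
    where
      step₁ : ∃ (Available col₀ (vtx v ∷ []) (inc v))
      step₁ = available-colour (slots-around u inc) (length-slots-around< u inc)
        (inc-conflicts₁ N (uncoloured #0) (through (listed #0) (listed #1) (λ w uw _ → listed (∈-around inc uw))))

      col₁ : Colouring n (D + 3)
      col₁ = col₀ [ inc v ↦ proj₁ step₁ ]

      step₂ : ∃ (Available col₁ [] (vtx v))
      step₂ = available-colour (vtx u ∷ inc u ∷ inc v ∷ [])
        (m≤D⇒2+m<D+3 (≤-trans (1≤degree G (Adj-sym G vu)) (degree≤D u)))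
        (vtx-conflicts₁ N (listed #2) (listed #0 , listed #1))

  module _ (s : Square G) where
    open Square s

    square-slots : List (Slot n)
    square-slots = inc x ∷ inc y ∷ vtx x ∷ vtx y ∷ []

    -- Giving vtx x the colour of inc b leaves vtx y only four colours to avoid.
    square-vertices-extend : ∀ {col₂} → ConflictFreeOutside col₂ (vtx x ∷ vtx y ∷ []) → Colourable G (D + 3)
    square-vertices-extend {col₂} free₂ = col₄ , ConflictFreeOutside-[] (extend (extend free₂ avail₃) (proj₂ step₄))
      where
        inc∉ : ∀ {v} → inc v ∉ map vtx (x ∷ y ∷ [])
        inc∉ = inc∉map-vtx (x ∷ y ∷ [])

        avail₃ : Available col₂ (vtx y ∷ []) (vtx x) (col₂ (inc b))
        avail₃ = vtx-conflicts₂ x-nbrs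
          (inj₂ (colour-≢ free₂ (inj₂ (a , ab , ax , b≢x)) inc∉ inc∉ refl))
          (inj₂ (colour-≢ free₂ (inj₂ (Adj-sym G ab)) inc∉ (vtx∉ (All¬⇒¬Any (Adj⇒≢ G ax ∷ a≢y ∷ []))) refl) ,
           inj₂ (colour-≢ free₂ (inj₁ (Adj-sym G ab)) inc∉ inc∉ refl))
          (uncoloured #0 , inj₂ (colour-≢ free₂ (inj₁ (Adj-sym G yb)) inc∉ inc∉ refl))

        col₃ : Colouring n (D + 3)
        col₃ = col₂ [ vtx x ↦ col₂ (inc b) ]

        step₄ : ∃ (Available col₃ [] (vtx y))
        step₄ = available-colour (vtx b ∷ inc b ∷ inc x ∷ inc y ∷ [])
          (m≤D⇒2+m<D+3 (≤-trans (2≤degree G (Adj-sym G xy) yb (b≢x ∘ sym)) (degree≤D y)))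
          (vtx-conflicts₂ y-nbrs (listed #3) (coloured-as #1 (↦-copied col₂ (vtx x) (inc b) (λ ())) , listed #2)
            (listed #0 , listed #1))

        col₄ : Colouring n (D + 3)
        col₄ = col₃ [ vtx y ↦ proj₁ step₄ ]

    square-extends : ∀ {col₀} → ConflictFreeOutside col₀ square-slots → Colourable G (D + 3)
    square-extends {col₀} free₀ = square-vertices-extend (extend (extend free₀ (proj₂ step₁)) (proj₂ step₂))
      where
        step₁ : ∃ (Available col₀ (inc y ∷ vtx x ∷ vtx y ∷ []) (inc x))
        step₁ = available-colour (slots-around a inc) (length-slots-around< a inc)
          (inc-conflicts₂ x-nbrs (uncoloured #1)
            (through (listed #0) (listed #1) (λ w aw _ → listed (∈-around inc aw)))
            (through₂ y-nbrs (uncoloured #2) (uncoloured #0) (listed (∈-around inc ab))))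

        col₁ : Colouring n (D + 3)
        col₁ = col₀ [ inc x ↦ proj₁ step₁ ]

        step₂ : ∃ (Available col₁ (vtx x ∷ vtx y ∷ []) (inc y))
        step₂ = available-colour (slots-around b (redirect y (inc x))) (length-slots-around< b _)
          (inc-conflicts₂ y-nbrs (uncoloured #1)
            (through₂ (swap ∘₂ x-nbrs) (uncoloured #0) (listed (∈-around-redirected (Adj-sym G yb)))
               (listed (∈-around-kept (Adj-sym G ab) a≢y)))
            (through (listed #0) (listed #1) (λ w bw w≢y → listed (∈-around-kept bw w≢y))))

  module _ (c : Chain G) where
    open Chain c

    a≢x : a ≢ x
    a≢x = Adj⇒≢ G ax

    y≢x : y ≢ x
    y≢x = Adj⇒≢ G xy ∘ sym

    b≢z : b ≢ z
    b≢z = Adj⇒≢ G zb ∘ sym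

    chain-vertices : List (Fin n)
    chain-vertices = x ∷ y ∷ z ∷ []

    chain-slots : List (Slot n)
    chain-slots = inc y ∷ inc z ∷ inc x ∷ vtx z ∷ vtx y ∷ vtx x ∷ []

    vertex-slots : List (Slot n)
    vertex-slots = map vtx (z ∷ y ∷ x ∷ [])

    off-chain : ∀ {v} → v ≢ x → v ≢ y → v ≢ z → vtx v ∉ chain-slots × inc v ∉ chain-slots
    off-chain v≢x v≢y v≢z =
      All¬⇒¬Any ((λ ()) ∷ (λ ()) ∷ (λ ()) ∷ vtx-≢ v≢z ∷ vtx-≢ v≢y ∷ vtx-≢ v≢x ∷ []) ,
      All¬⇒¬Any (inc-≢ v≢y ∷ inc-≢ v≢z ∷ inc-≢ v≢x ∷ (λ ()) ∷ (λ ()) ∷ (λ ()) ∷ [])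

    record IncidencesColoured (col₀ : Colouring n (D + 3)) (r : Slot n) : Set where
      field
        colouring : Colouring n (D + 3)
        free : ConflictFreeOutside colouring vertex-slots
        inc-y≡r : colouring (inc y) ≡ colouring r
        unchanged : ∀ {q} → q ≢ inc y → q ≢ inc z → q ≢ inc x → colouring q ≡ col₀ q

    -- inc y copies the colour of a slot r around a, so that inc x has room.
    colour-incidences : ∀ {col₀ r} → ConflictFreeOutside col₀ chain-slots →
                        r ≢ inc y → r ≢ inc z → r ≢ inc x → r ∈ slots-around a (redirect x (inc z)) →
                        col₀ r ≢ col₀ (inc a) → col₀ r ≢ col₀ (inc b) → IncidencesColoured col₀ r
    colour-incidences {col₀} {r} free₀ r≢y r≢z r≢x r∈ r≢a r≢b = record
      { colouring = col₂ [ inc x ↦ proj₁ step₃ ]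
      ; free = extend free₂ (proj₂ step₃)
      ; inc-y≡r = ↦-preserves-≡ col₂ (inc x) _ (inc-≢ y≢x) r≢x inc-y≡r₂
      ; unchanged = λ q≢y q≢z q≢x →
          trans (↦-other col₂ _ _ q≢x) (trans (↦-other col₁ _ _ q≢z) (↦-other col₀ _ _ q≢y))
      }
      where
        avail₁ : Available col₀ (inc z ∷ inc x ∷ vtx z ∷ vtx y ∷ vtx x ∷ []) (inc y) (col₀ r)
        avail₁ = inc-conflicts₂ y-nbrs (uncoloured #3)
          (through₂ (swap ∘₂ x-nbrs) (uncoloured #4) (uncoloured #1) (inj₂ r≢a))
          (through₂ z-nbrs (uncoloured #2) (uncoloured #0) (inj₂ r≢b))

        col₁ : Colouring n (D + 3)
        col₁ = col₀ [ inc y ↦ col₀ r ]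

        step₂ : ∃ (Available col₁ (inc x ∷ vtx z ∷ vtx y ∷ vtx x ∷ []) (inc z))
        step₂ = available-colour (slots-around b (redirect z (inc y))) (length-slots-around< b _)
          (inc-conflicts₂ z-nbrs (uncoloured #1)
            (through₂ (swap ∘₂ y-nbrs) (uncoloured #2) (listed (∈-around-redirected (Adj-sym G zb))) (uncoloured #0))
            (through (listed #0) (listed #1) (λ w bw w≢z → listed (∈-around-kept bw w≢z))))

        col₂ : Colouring n (D + 3)
        col₂ = col₁ [ inc z ↦ proj₁ step₂ ]

        free₂ : ConflictFreeOutside col₂ (inc x ∷ vertex-slots)
        free₂ = extend (extend free₀ avail₁) (proj₂ step₂)

        inc-y≡r₂ : col₂ (inc y) ≡ col₂ r
        inc-y≡r₂ = ↦-preserves-≡ col₁ (inc z) _ (inc-≢ (Adj⇒≢ G yz)) r≢z (↦-copied col₀ (inc y) r r≢y)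

        step₃ : ∃ (Available col₂ vertex-slots (inc x))
        step₃ = available-colour (slots-around a (redirect x (inc z))) (length-slots-around< a _)
          (inc-conflicts₂ x-nbrs (uncoloured #2)
            (through (listed #0) (listed #1) (λ w aw w≢x → listed (∈-around-kept aw w≢x)))
            (through₂ y-nbrs (uncoloured #1) (coloured-as r∈ inc-y≡r₂) (listed (∈-around-redirected ax))))

    colour-vertices-greedily : ∀ {col₃} → ConflictFreeOutside col₃ vertex-slots →
                               col₃ (inc y) ≡ col₃ (vtx a) → Colourable G (D + 3)
    colour-vertices-greedily {col₃} free₃ inc-y≡vtx-a =
      col₅ [ vtx x ↦ proj₁ step₆ ] , ConflictFreeOutside-[] (extend free₅ (proj₂ step₆))
      where
        four-fit : 2 + 2 < D + 3
        four-fit = m≤D⇒2+m<D+3 (≤-trans (2≤degree G (Adj-sym G yz) zb (b≢y ∘ sym)) (degree≤D z))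

        step₄ : ∃ (Available col₃ (vtx y ∷ vtx x ∷ []) (vtx z))
        step₄ = available-colour (vtx b ∷ inc b ∷ inc z ∷ inc y ∷ []) four-fit
          (vtx-conflicts₂ z-nbrs (listed #2) (uncoloured #0 , listed #3) (listed #0 , listed #1))

        col₄ : Colouring n (D + 3)
        col₄ = col₃ [ vtx z ↦ proj₁ step₄ ]

        step₅ : ∃ (Available col₄ (vtx x ∷ []) (vtx y))
        step₅ = available-colour (vtx z ∷ inc y ∷ inc x ∷ inc z ∷ []) four-fit
          (vtx-conflicts₂ y-nbrs (listed #1) (uncoloured #0 , listed #2) (listed #0 , listed #3))

        col₅ : Colouring n (D + 3)
        col₅ = col₄ [ vtx y ↦ proj₁ step₅ ]

        free₅ : ConflictFreeOutside col₅ (vtx x ∷ [])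
        free₅ = extend (extend free₃ (proj₂ step₄)) (proj₂ step₅)

        inc-y≡vtx-a₅ : col₅ (inc y) ≡ col₅ (vtx a)
        inc-y≡vtx-a₅ = ↦-preserves-≡ col₄ (vtx y) _ (λ ()) (vtx-≢ a≢y)
          (↦-preserves-≡ col₃ (vtx z) _ (λ ()) (vtx-≢ a≢z) inc-y≡vtx-a)

        step₆ : ∃ (Available col₅ [] (vtx x))
        step₆ = available-colour (vtx a ∷ vtx y ∷ inc x ∷ inc a ∷ []) four-fit
          (vtx-conflicts₂ x-nbrs (listed #2) (listed #0 , listed #3) (listed #1 , coloured-as #0 inc-y≡vtx-a₅))

    vtx-x-copies-inc-z : ∀ {col₅} → ConflictFreeOutside col₅ (vtx x ∷ []) →
                         col₅ (vtx a) ≡ col₅ (inc b) → col₅ (vtx b) ≡ col₅ (inc a) → Colourable G (D + 3)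
    vtx-x-copies-inc-z {col₅} free₅ a≈b b≈a = col₅ [ vtx x ↦ col₅ (inc z) ] , ConflictFreeOutside-[] (extend free₅ avail₆)
      where
        inc∉ : ∀ {v} → inc v ∉ map vtx (x ∷ [])
        inc∉ = inc∉map-vtx (x ∷ [])

        vtx∉ₓ : ∀ {v} → v ≢ x → vtx v ∉ vtx x ∷ []
        vtx∉ₓ v≢x = vtx∉ (All¬⇒¬Any (v≢x ∷ []))

        avail₆ : Available col₅ [] (vtx x) (col₅ (inc z))
        avail₆ = vtx-conflicts₂ x-nbrs
          (inj₂ (colour-≢ free₅ (inj₂ (y , yz , Adj-sym G xy , x≢z ∘ sym)) inc∉ inc∉ refl))
          (inj₂ (colour-≢ free₅ (inj₁ zb) inc∉ inc∉ a≈b) ,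
           inj₂ (colour-≢ free₅ (inj₂ zb) inc∉ (vtx∉ₓ b≢x) (sym b≈a)))
          (inj₂ (colour-≢ free₅ (inj₂ (Adj-sym G yz)) inc∉ (vtx∉ₓ y≢x) refl) ,
           inj₂ (colour-≢ free₅ (inj₁ (Adj-sym G yz)) inc∉ inc∉ refl))

    -- Once vtx a, inc b and vtx b, inc a are coloured alike, vtx z and vtx x can copy inc x and inc z.
    colour-vertices-crosswise : ∀ {col₃} → ConflictFreeOutside col₃ vertex-slots →
                                col₃ (vtx a) ≡ col₃ (inc b) → col₃ (vtx b) ≡ col₃ (inc a) → Colourable G (D + 3)
    colour-vertices-crosswise {col₃} free₃ a≈b b≈a =
      vtx-x-copies-inc-z free₅ (kept (vtx-≢ a≢z) (vtx-≢ a≢y) (λ ()) (λ ()) a≈b)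
                               (kept (vtx-≢ (b≢z)) (vtx-≢ b≢y) (λ ()) (λ ()) b≈a)
      where
        inc∉ : ∀ {v} → inc v ∉ vertex-slots
        inc∉ = inc∉map-vtx (z ∷ y ∷ x ∷ [])

        avail₄ : Available col₃ (vtx y ∷ vtx x ∷ []) (vtx z) (col₃ (inc x))
        avail₄ = vtx-conflicts₂ z-nbrs
          (inj₂ (colour-≢ free₃ (inj₂ (y , Adj-sym G xy , yz , x≢z)) inc∉ inc∉ refl))
          (uncoloured #0 , inj₂ (colour-≢ free₃ (inj₁ xy) inc∉ inc∉ refl))
          (inj₂ (colour-≢ free₃ (inj₁ (Adj-sym G ax)) inc∉ inc∉ b≈a) ,
           inj₂ (colour-≢ free₃ (inj₂ (Adj-sym G ax)) inc∉ (vtx∉ (All¬⇒¬Any (a≢z ∷ a≢y ∷ a≢x ∷ []))) (sym a≈b)))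

        col₄ : Colouring n (D + 3)
        col₄ = col₃ [ vtx z ↦ col₃ (inc x) ]

        step₅ : ∃ (Available col₄ (vtx x ∷ []) (vtx y))
        step₅ = available-colour (inc y ∷ inc x ∷ inc z ∷ []) (m≤D⇒2+m<D+3 (≤-trans (1≤degree G xy) (degree≤D x)))
          (vtx-conflicts₂ y-nbrs (listed #0) (uncoloured #0 , listed #1)
            (coloured-as #1 (↦-copied col₃ (vtx z) (inc x) (λ ())) , listed #2))

        col₅ : Colouring n (D + 3)
        col₅ = col₄ [ vtx y ↦ proj₁ step₅ ]

        free₅ : ConflictFreeOutside col₅ (vtx x ∷ [])
        free₅ = extend (extend free₃ avail₄) (proj₂ step₅)

        kept : ∀ {q r} → q ≢ vtx z → q ≢ vtx y → r ≢ vtx z → r ≢ vtx y → col₃ q ≡ col₃ r → col₅ q ≡ col₅ r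
        kept q≢z q≢y r≢z r≢y e = ↦-preserves-≡ col₄ (vtx y) _ q≢y r≢y (↦-preserves-≡ col₃ (vtx z) _ q≢z r≢z e)

    greedy-case : ∀ {col₀} → ConflictFreeOutside col₀ chain-slots → col₀ (vtx a) ≢ col₀ (inc b) →
                  Colourable G (D + 3)
    greedy-case {col₀} free₀ a≉b = colour-vertices-greedily free inc-y≡r
      where
        vtx-a≉inc-a : col₀ (vtx a) ≢ col₀ (inc a)
        vtx-a≉inc-a = free₀ (vtx a) (inc a) (inj₁ refl) (proj₁ (off-chain a≢x a≢y a≢z)) (proj₂ (off-chain a≢x a≢y a≢z))

        open IncidencesColoured (colour-incidences free₀ (λ ()) (λ ()) (λ ()) #0 vtx-a≉inc-a a≉b)

    crosswise-case : ∀ {col₀ A} → ConflictFreeOutside col₀ chain-slots → Adj G a A → A ≢ x →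
                     col₀ (vtx a) ≡ col₀ (inc b) → col₀ (vtx b) ≡ col₀ (inc a) → Colourable G (D + 3)
    crosswise-case {col₀} {A} free₀ aA A≢x a≈b b≈a = colour-vertices-crosswise free
      (trans (unchanged (λ ()) (λ ()) (λ ())) (trans a≈b (sym (unchanged (inc-≢ b≢y) (inc-≢ b≢z) (inc-≢ b≢x)))))
      (trans (unchanged (λ ()) (λ ()) (λ ())) (trans b≈a (sym (unchanged (inc-≢ a≢y) (inc-≢ a≢z) (inc-≢ a≢x)))))
      where
        A≢y : A ≢ y
        A≢y refl = [ a≢x , a≢z ] (y-nbrs a (Adj-sym G aA))

        A≢z : A ≢ z
        A≢z refl = [ a≢y , a≢b ] (z-nbrs a (Adj-sym G aA))

        inc-A∉ : inc A ∉ chain-slots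
        inc-A∉ = proj₂ (off-chain A≢x A≢y A≢z)

        a-off : vtx a ∉ chain-slots × inc a ∉ chain-slots
        a-off = off-chain a≢x a≢y a≢z

        open IncidencesColoured (colour-incidences free₀ (inc-≢ A≢y) (inc-≢ A≢z) (inc-≢ A≢x) (∈-around-kept aA A≢x)
          (free₀ (inc A) (inc a) (inj₁ (Adj-sym G aA)) inc-A∉ (proj₂ a-off))
          (colour-≢ free₀ (inj₂ (Adj-sym G aA)) inc-A∉ (proj₁ a-off) (sym a≈b)))

    chain-slots-complete : AllSlotsIn chain-vertices chain-slots
    chain-slots-complete #0 = #5 , #2
    chain-slots-complete #1 = #4 , #0
    chain-slots-complete #2 = #3 , #1

  reverse-slots-complete : ∀ c → AllSlotsIn (chain-vertices c) (chain-slots (reverse G c))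
  reverse-slots-complete c #0 = #3 , #1
  reverse-slots-complete c #1 = #4 , #0
  reverse-slots-complete c #2 = #5 , #2

  chain-extends : ∀ c {A} → Adj G (Chain.a c) A → A ≢ Chain.x c → ∀ {col₀} →
                  (∀ {rem} → AllSlotsIn (chain-vertices c) rem → ConflictFreeOutside col₀ rem) →
                  Colourable G (D + 3)
  chain-extends c aA A≢x {col₀} free
    with col₀ (vtx (Chain.a c)) ≟ᶠ col₀ (inc (Chain.b c)) | col₀ (vtx (Chain.b c)) ≟ᶠ col₀ (inc (Chain.a c))
  ... | no a≉b | _ = greedy-case c (free (chain-slots-complete c)) a≉b
  ... | yes _ | no b≉a = greedy-case (reverse G c) (free (reverse-slots-complete c)) b≉a
  ... | yes a≈b | yes b≈a = crosswise-case c (free (chain-slots-complete c)) aA A≢x a≈b b≈a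

-- Structure of triangle-free outerplanar graphs

NoCrossing : ∀ {n} → (Fin n → ℕ) → Graph n → Set
NoCrossing pos G = ∀ a b c d → Adj G a b → Adj G c d → ¬ Crossing (pos a) (pos b) (pos c) (pos d)

nested-shorter : ∀ {a a′ b′ b} → a ≤ a′ → a′ ≤ b′ → b′ ≤ b → a < a′ ⊎ b′ < b → b′ ∸ a′ < b ∸ a
nested-shorter {a} a≤a′ a′≤b′ b′≤b (inj₁ a<a′) = <-≤-trans (∸-monoʳ-< a<a′ a′≤b′) (∸-monoˡ-≤ a b′≤b)
nested-shorter {b′ = b′} a≤a′ a′≤b′ b′≤b (inj₂ b′<b) =
  ≤-<-trans (∸-monoʳ-≤ b′ a≤a′) (∸-monoˡ-< b′<b (≤-trans a≤a′ a′≤b′))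

module Structure {n : ℕ} (G : Graph n) (pos : Fin n → ℕ) (pos-injective : ∀ {u v} → pos u ≡ pos v → u ≡ v)
                 (planar : NoCrossing pos G) (triangle-free : TriangleFree G) where

  ≢-pos : ∀ {u v} → pos u < pos v → u ≢ v
  ≢-pos u<v refl = <-irrefl refl u<v

  left-or-right : ∀ {s w} → Adj G s w → pos w < pos s ⊎ pos s < pos w
  left-or-right {s} {w} sw with <-cmp (pos w) (pos s)
  ... | tri< w<s _ _ = inj₁ w<s
  ... | tri≈ _ w≡s _ = ⊥-elim (Adj⇒≢ G sw (sym (pos-injective w≡s)))
  ... | tri> _ _ s<w = inj₂ s<w

  NonIsolated : Fin n → Set
  NonIsolated v = ∃ (Adj G v)

  NonIsolated? : Decidable NonIsolated
  NonIsolated? v = any? (Adj? G v)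

  Between : ℕ → ℕ → Fin n → Set
  Between i j m = i < pos m × pos m < j × NonIsolated m

  Between? : ∀ i j → Decidable (Between i j)
  Between? i j m = (i <? pos m) ×-dec (pos m <? j) ×-dec NonIsolated? m

  Spans : Fin n → Fin n → Set
  Spans u v = Adj G u v × pos u < pos v × ∃ (Between (pos u) (pos v))

  Spans? : ∀ u v → Dec (Spans u v)
  Spans? u v = Adj? G u v ×-dec (pos u <? pos v) ×-dec any? (Between? (pos u) (pos v))

  leaf-without-spans : (∀ u v → ¬ Spans u v) → ∀ {u₀ v₀} → Adj G u₀ v₀ → Reducible G
  leaf-without-spans no-span a₀ with minimal-witness pos NonIsolated? (allFin n) ∈-allFin (_ , a₀)
  ... | s , (w₀ , sw₀) , leftmost = leaf sw₀ only
    where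
      rightward : ∀ {w} → Adj G s w → pos s < pos w
      rightward {w} sw = [ (λ w<s → ⊥-elim (<⇒≱ w<s (leftmost w (s , Adj-sym G sw)))) , id ] (left-or-right sw)

      -- A second right neighbour would lie under the chord to the farther one.
      only : OnlyNeighbour G s w₀
      only w sw with <-cmp (pos w) (pos w₀)
      ... | tri≈ _ e _ = pos-injective e
      ... | tri< w<w₀ _ _ = ⊥-elim (no-span s w₀ (sw₀ , rightward sw₀ , w , rightward sw , w<w₀ , s , Adj-sym G sw))
      ... | tri> _ _ w₀<w = ⊥-elim (no-span s w (sw , rightward sw , w₀ , rightward sw₀ , w₀<w , s , Adj-sym G sw₀))

  module MinimalSpan {u v : Fin n} (uv : Adj G u v)
                     (shortest : ∀ {u′ v′} → Spans u′ v′ → pos v ∸ pos u ≤ pos v′ ∸ pos u′) where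

    Inside : Fin n → Set
    Inside s = pos u < pos s × pos s < pos v

    within-span : ∀ {s w} → Inside s → Adj G s w → pos u ≤ pos w × pos w ≤ pos v
    within-span {s} {w} (u<s , s<v) sw =
      ≮⇒≥ (λ w<u → planar w s u v (Adj-sym G sw) uv (w<u , u<s , s<v)) ,
      ≮⇒≥ (λ v<w → planar u v s w uv sw (u<s , s<v , v<w))

    no-nested-span : ∀ {w₁ w₂ s} → Adj G w₁ w₂ → pos u ≤ pos w₁ → pos w₂ ≤ pos v →
                     pos u < pos w₁ ⊎ pos w₂ < pos v → pos w₁ < pos s → pos s < pos w₂ → NonIsolated s → ⊥
    no-nested-span a u≤w₁ w₂≤v strict w₁<s s<w₂ s-ni =
      <⇒≱ (nested-shorter u≤w₁ (<⇒≤ (<-trans w₁<s s<w₂)) w₂≤v strict)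
          (shortest (a , <-trans w₁<s s<w₂ , _ , w₁<s , s<w₂ , s-ni))

    one-right-neighbour : ∀ {s w₁ w₂} → Inside s → Adj G s w₁ → Adj G s w₂ → pos s < pos w₁ → pos s < pos w₂ → w₁ ≡ w₂
    one-right-neighbour {s} {w₁} {w₂} s-in@(u<s , _) sw₁ sw₂ s<w₁ s<w₂ with <-cmp (pos w₁) (pos w₂)
    ... | tri≈ _ e _ = pos-injective e
    ... | tri< w₁<w₂ _ _ =
      ⊥-elim (no-nested-span sw₂ (<⇒≤ u<s) (proj₂ (within-span s-in sw₂)) (inj₁ u<s) s<w₁ w₁<w₂ (s , Adj-sym G sw₁))
    ... | tri> _ _ w₂<w₁ =
      ⊥-elim (no-nested-span sw₁ (<⇒≤ u<s) (proj₂ (within-span s-in sw₁)) (inj₁ u<s) s<w₂ w₂<w₁ (s , Adj-sym G sw₂))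

    one-left-neighbour : ∀ {s w₁ w₂} → Inside s → Adj G s w₁ → Adj G s w₂ → pos w₁ < pos s → pos w₂ < pos s → w₁ ≡ w₂
    one-left-neighbour {s} {w₁} {w₂} s-in@(_ , s<v) sw₁ sw₂ w₁<s w₂<s with <-cmp (pos w₁) (pos w₂)
    ... | tri≈ _ e _ = pos-injective e
    ... | tri< w₁<w₂ _ _ = ⊥-elim (no-nested-span (Adj-sym G sw₁) (proj₁ (within-span s-in sw₁)) (<⇒≤ s<v)
                                     (inj₂ s<v) w₁<w₂ w₂<s (s , Adj-sym G sw₂))
    ... | tri> _ _ w₂<w₁ = ⊥-elim (no-nested-span (Adj-sym G sw₂) (proj₁ (within-span s-in sw₂)) (<⇒≤ s<v)
                                     (inj₂ s<v) w₂<w₁ w₁<s (s , Adj-sym G sw₁))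

    step-right : ∀ {s ℓ} → Inside s → (∀ {w} → Adj G s w → pos w < pos s → w ≡ ℓ) →
                 OnlyNeighbour G s ℓ ⊎ ∃[ r ] (Adj G s r × pos s < pos r × OnlyNeighbours G s ℓ r)
    step-right {s} s-in left with any? (λ w → Adj? G s w ×-dec (pos s <? pos w))
    ... | no none = inj₁ λ w sw → [ left sw , (λ s<w → ⊥-elim (none (w , sw , s<w))) ] (left-or-right sw)
    ... | yes (r , sr , s<r) =
      inj₂ (r , sr , s<r , λ w sw → [ inj₁ ∘ left sw , (λ s<w → inj₂ (one-right-neighbour s-in sw sr s<w s<r)) ]
                                    (left-or-right sw))

    first-left-neighbour : ∀ {m} → Inside m → (∀ w → Between (pos u) (pos v) w → pos m ≤ pos w) →
                           ∀ {w} → Adj G m w → pos w < pos m → w ≡ u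
    first-left-neighbour m-in@(_ , m<v) first {w} mw w<m with <-cmp (pos u) (pos w)
    ... | tri≈ _ e _ = pos-injective (sym e)
    ... | tri< u<w _ _ = ⊥-elim (<⇒≱ w<m (first w (u<w , <-trans w<m m<v , _ , Adj-sym G mw)))
    ... | tri> _ _ w<u = ⊥-elim (<⇒≱ w<u (proj₁ (within-span m-in mw)))

    next-inside : ∀ {m q} → Inside m → Adj G m u → Adj G m q → pos m < pos q → Inside q
    next-inside m-in@(u<m , _) mu mq m<q =
      <-trans u<m m<q ,
      ≤∧≢⇒< (proj₂ (within-span m-in mq))
             (λ q≡v → triangle-free _ _ v (Adj-sym G mu) (subst (Adj G _) (pos-injective q≡v) mq) uv)

    walk-from-third : ∀ {m q t} → Adj G m u → Adj G m q → Adj G q t → OnlyNeighbours G m u q → OnlyNeighbours G q m t →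
              Inside m → pos m < pos q → pos q < pos t → Inside t → Reducible G
    walk-from-third {m} {q} {t} mu mq qt Nm Nq m-in@(u<m , m<v) m<q q<t t-in@(u<t , _)
      with step-right t-in (λ tw w<t → one-left-neighbour t-in tw (Adj-sym G qt) w<t q<t)
    ... | inj₁ only = leaf (Adj-sym G qt) only
    ... | inj₂ (b , tb , t<b , Nt) = chain path uv (≢-pos m<v ∘ sym)
      where
        path : Chain G
        path = record
          { a = u ; x = m ; y = q ; z = t ; b = b
          ; ax = Adj-sym G mu ; xy = mq ; yz = qt ; zb = tb
          ; x-nbrs = Nm ; y-nbrs = Nq ; z-nbrs = Nt
          ; a≢y = ≢-pos (<-trans u<m m<q) ; a≢z = ≢-pos u<t ; a≢b = ≢-pos (<-trans u<t t<b)
          ; b≢x = ≢-pos (<-trans m<q (<-trans q<t t<b)) ∘ sym ; b≢y = ≢-pos (<-trans q<t t<b) ∘ sym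
          ; x≢z = ≢-pos (<-trans m<q q<t) }

    walk-from-second : ∀ {m q} → Adj G m u → Adj G m q → OnlyNeighbours G m u q → Inside m → pos m < pos q → Inside q →
              Reducible G
    walk-from-second {m} {q} mu mq Nm m-in@(_ , m<v) m<q q-in@(u<q , q<v)
      with step-right q-in (λ qw w<q → one-left-neighbour q-in qw (Adj-sym G mq) w<q m<q)
    ... | inj₁ only = leaf (Adj-sym G mq) only
    ... | inj₂ (t , qt , q<t , Nq) with <-cmp (pos t) (pos v)
    ...   | tri> _ _ v<t = ⊥-elim (<⇒≱ v<t (proj₂ (within-span q-in qt)))
    ...   | tri< t<v _ _ = walk-from-third mu mq qt Nm Nq m-in m<q q<t (<-trans u<q q<t , t<v)
    ...   | tri≈ _ t≡v _ with pos-injective t≡v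
    ...     | refl = square (record
              { a = u ; x = m ; y = q ; b = v
              ; ax = Adj-sym G mu ; xy = mq ; yb = qt ; ab = uv
              ; x-nbrs = Nm ; y-nbrs = Nq
              ; a≢y = ≢-pos u<q ; b≢x = ≢-pos m<v ∘ sym })

    walk-from-first : ∀ {m} → Inside m → NonIsolated m → (∀ w → Between (pos u) (pos v) w → pos m ≤ pos w) → Reducible G
    walk-from-first {m} m-in (w₀ , mw₀) first with step-right m-in (first-left-neighbour m-in first)
    ... | inj₁ only = leaf (subst (Adj G m) (only w₀ mw₀) mw₀) only
    ... | inj₂ (q , mq , m<q , Nm) with Adj? G m u
    ...   | no ¬mu = leaf mq λ w mw → [ (λ w≡u → ⊥-elim (¬mu (subst (Adj G m) w≡u mw))) , id ] (Nm w mw)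
    ...   | yes mu = walk-from-second mu mq Nm m-in m<q (next-inside m-in mu mq m<q)

    -- Walk right from the leftmost non-isolated vertex m under the chord uv.
    span-reducible : ∃ (Between (pos u) (pos v)) → Reducible G
    span-reducible (_ , between)
      with minimal-witness pos (Between? (pos u) (pos v)) (allFin n) ∈-allFin between
    ... | m , (u<m , m<v , m-ni) , first = walk-from-first (u<m , m<v) m-ni first

  reducible-configuration : ∀ {u₀ v₀} → Adj G u₀ v₀ → Reducible G
  reducible-configuration a₀ with any? (λ u → any? (Spans? u))
  ... | no no-span = leaf-without-spans (λ u v s → no-span (u , v , s)) a₀
  ... | yes (_ , _ , span) with minimal-witness (uncurry λ u v → pos v ∸ pos u) (uncurry Spans?)
                                (cartesianProduct (allFin n) (allFin n))
                                (λ (u , v) → ∈-cartesianProduct⁺ (∈-allFin u) (∈-allFin v)) span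
  ...   | _ , (uv , _ , between) , shortest = MinimalSpan.span-reducible uv (λ s → shortest _ s) between

-- Induction on the degree sum

module Main {n : ℕ} (pos : Fin n → ℕ) (pos-injective : ∀ {u v} → pos u ≡ pos v → u ≡ v) (D : ℕ) where

  Hypotheses : Graph n → Set
  Hypotheses G = TriangleFree G × NoCrossing pos G × (∀ v → degree G v ≤ D)

  ∖-hypotheses : ∀ G S → Hypotheses G → Hypotheses (G ∖ S)
  ∖-hypotheses G S (triangle-free , planar , bounded) =
    (λ a b c ab bc ac → triangle-free a b c (kept ab) (kept bc) (kept ac)) ,
    (λ a b c d ab cd → planar a b c d (kept ab) (kept cd)) ,
    (λ v → ≤-trans (degree-∖-≤ G S v) (bounded v))
    where
      kept : ∀ {u v} → Adj (G ∖ S) u v → Adj G u v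
      kept = ∖-Adj⁻ G S

  edgeless-colourable : ∀ {G} → (∀ u v → ¬ Adj G u v) → Colourable G (D + 3)
  edgeless-colourable {G} none = colour , proper
    where
      colour : Colouring n (D + 3)
      colour (vtx _) = D ↑ʳ fzero
      colour (inc _) = D ↑ʳ fsuc fzero

      proper : ConflictFree G colour
      proper (vtx u) (vtx v) a = ⊥-elim (none u v a)
      proper (vtx u) (inc v) (inj₁ _) e with () ← ↑ʳ-injective D fzero (fsuc fzero) e
      proper (vtx u) (inc v) (inj₂ a) = ⊥-elim (none u v a)
      proper (inc u) (vtx v) (inj₁ _) e with () ← ↑ʳ-injective D (fsuc fzero) fzero e
      proper (inc u) (vtx v) (inj₂ a) = ⊥-elim (none u v a)
      proper (inc u) (inc v) (inj₁ a) = ⊥-elim (none u v a)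
      proper (inc u) (inc v) (inj₂ (w , wu , _)) = ⊥-elim (none w u wu)

  module _ (G : Graph n) (hyp : Hypotheses G)
           (IH : ∀ {G′} → degree-sum G′ < degree-sum G → Hypotheses G′ → Colourable G′ (D + 3)) where
    open Extension G D (proj₂ (proj₂ hyp))
    open PartialColouring G (D + 3)

    colourable-∖ : ∀ S {s w} → s ∈ S → Adj G s w → Colourable (G ∖ S) (D + 3)
    colourable-∖ S s∈ sw = IH (degree-sum-∖-< G S s∈ sw) (∖-hypotheses G S hyp)

    restricted : ∀ S {s w} (s∈ : s ∈ S) (sw : Adj G s w) → AtMostOneNeighbourOutside G S →
                 ∀ {rem} → AllSlotsIn S rem → ConflictFreeOutside (proj₁ (colourable-∖ S s∈ sw)) rem
    restricted S s∈ sw one slots = ConflictFree-∖⇒ConflictFreeOutside G S one slots (proj₂ (colourable-∖ S s∈ sw))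

    reducible-colourable : Reducible G → Colourable G (D + 3)
    reducible-colourable (leaf {v} vu only) = leaf-extends vu only (restricted (v ∷ []) #0 vu one slots)
      where
        one : AtMostOneNeighbourOutside G (v ∷ [])
        one #0 vu′ vw _ _ = trans (only _ vu′) (sym (only _ vw))
        slots : AllSlotsIn (v ∷ []) (inc v ∷ vtx v ∷ [])
        slots #0 = #1 , #0
    reducible-colourable (square s) = square-extends s (restricted (x ∷ y ∷ []) #0 (Adj-sym G ax) one slots)
      where
        open Square s
        one : AtMostOneNeighbourOutside G (x ∷ y ∷ [])
        one #0 = neighbours-outside-agree G x-nbrs #1
        one #1 = neighbours-outside-agree G (swap ∘₂ y-nbrs) #0
        slots : AllSlotsIn (x ∷ y ∷ []) (square-slots s)
        slots #0 = #2 , #0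
        slots #1 = #3 , #1
    reducible-colourable (chain c aA A≢x) = chain-extends c aA A≢x (restricted (x ∷ y ∷ z ∷ []) #0 (Adj-sym G ax) one)
      where
        open Chain c
        one : AtMostOneNeighbourOutside G (x ∷ y ∷ z ∷ [])
        one #0 = neighbours-outside-agree G x-nbrs #1
        one #1 = neighbours-outside-agree G y-nbrs #2
        one #2 = neighbours-outside-agree G (swap ∘₂ z-nbrs) #1

    colourable-step : Colourable G (D + 3)
    colourable-step with any? (λ u → any? (Adj? G u))
    ... | no none = edgeless-colourable (λ u v a → none (u , v , a))
    ... | yes (_ , _ , a₀) = reducible-colourable
      (Structure.reducible-configuration G pos pos-injective (proj₁ (proj₂ hyp)) (proj₁ hyp) a₀)

  colourable : ∀ G → Hypotheses G → Colourable G (D + 3)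
  colourable = WF.All.wfRec (On.wellFounded degree-sum <-wellFounded) _
    (λ G → Hypotheses G → Colourable G (D + 3)) (λ G IH hyp → colourable-step G hyp IH)

theorem19 : ∀ {n : ℕ} (G : Graph n) → TriangleFree G → Outerplanar G →
    HasVISColoring G (Δ G + 3) 1
theorem19 G triangle-free (σ , planar) = uncurry (ConflictFree⇒HasVISColoring G)
  (Main.colourable pos pos-injective (Δ G) G (triangle-free , planar , degree≤Δ G))
  where
    pos : Fin _ → ℕ
    pos = toℕ ∘ Inverse.to σ

    pos-injective : ∀ {u v} → pos u ≡ pos v → u ≡ v
    pos-injective = Injection.injective (↔⇒↣ σ) ∘ toℕ-injective
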